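{- If a class of predicates $\mathbb{P}$ is closed under conjunction, then every safety problem that is provable in $\mathbf{FI}^{\mathbb{P}}$ is provable in $\mathbf{F}^{\mathbb{P}}$.
   Context: Let $\Sigma$ be a first-order vocabulary and $\Sigma'$ its primed copy; $\varphi'$ denotes $\varphi$ with every symbol primed. A safety problem is a triple $(\iota,\tau,\beta)$ of closed formulas, $\iota,\beta$ over $\Sigma$ and $\tau$ over $\Sigma\cup\Sigma'$. $A\Rightarrow B$ denotes validity of $A\to B$. Rules: (Ind): with no premises, conclude $(\iota,\tau,\neg\varphi)$ provided $\iota\Rightarrow\varphi$ and $\varphi\wedge\tau\Rightarrow\varphi'$; (Cons): from $(\iota,\tau,\neg\varphi)$ conclude $(\iota,\tau,\beta)$ provided $\varphi\Rightarrow\neg\beta$; (Inc): from premises $(\iota,\tau,\neg\varphi)$ and $(\iota\wedge\varphi,\tau\wedge\varphi\wedge\varphi',\beta\wedge\varphi)$ conclude $(\iota,\tau,\beta)$. The system $\mathbf{F}$ consists of (Ind) and (Cons); $\mathbf{FI}$ consists of (Ind), (Cons), (Inc). A proof is a finite tree of safety problems, each node the conclusion of a rule applied to its children; a problem is provable if it is the root of a proof. For a class of predicates $\mathbb{P}$, $\mathbf{F}^{\mathbb{P}}$ and $\mathbf{FI}^{\mathbb{P}}$ denote these systems with every application of (Ind) restricted to $\varphi\in\mathbb{P}$. -}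

module Defs where

open import Data.Nat using (ℕ; zero; suc)
open import Data.Fin using (Fin; zero; suc)
open import Data.Vec using (Vec; []; _∷_)
open import Data.Bool using (Bool; true; false; T)
open import Data.Product using (_×_; _,_; proj₁; proj₂)
open import Relation.Nullary using (¬_)
open import Relation.Binary.PropositionalEquality using (_≡_)

record Vocab : Set₁ where
  field
    Fun   : Set
    Rel   : Set
    funAr : Fun → ℕ
    relAr : Rel → ℕ
open Vocab public

data Term (S : Vocab) (n : ℕ) : Set where
  var : Fin n → Term S n
  app : (f : Fun S) → Vec (Term S n) (funAr S f) → Term S n

data Formula (S : Vocab) : ℕ → Set where
  rel  : ∀ {n} (r : Rel S) → Vec (Term S n) (relAr S r) → Formula S n
  _≐_  : ∀ {n} → Term S n → Term S n → Formula S n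
  neg  : ∀ {n} → Formula S n → Formula S n
  _and_ : ∀ {n} → Formula S n → Formula S n → Formula S n
  all  : ∀ {n} → Formula S (suc n) → Formula S n

infixr 6 _and_
infixr 5 _imp_

_imp_ : ∀ {S n} → Formula S n → Formula S n → Formula S n
A imp B = neg (A and neg B)

-- Semantics (Tarskian; relations are Bool-valued and equality is read
-- as ¬¬≡, so satisfaction is ¬¬-stable, i.e. classical).

record Structure (S : Vocab) : Set₁ where
  field
    Carrier : Set
    point   : Carrier
    funI    : (f : Fun S) → Vec Carrier (funAr S f) → Carrier
    relI    : (r : Rel S) → Vec Carrier (relAr S r) → Bool
open Structure public

module _ {S : Vocab} (M : Structure S) where
  mutual
    evalT : ∀ {n} → (Fin n → Carrier M) → Term S n → Carrier M
    evalT ρ (var i)    = ρ i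
    evalT ρ (app f ts) = funI M f (evalTs ρ ts)

    evalTs : ∀ {n k} → (Fin n → Carrier M) → Vec (Term S n) k → Vec (Carrier M) k
    evalTs ρ []       = []
    evalTs ρ (t ∷ ts) = evalT ρ t ∷ evalTs ρ ts

  extend : ∀ {n} → Carrier M → (Fin n → Carrier M) → Fin (suc n) → Carrier M
  extend d ρ zero    = d
  extend d ρ (suc i) = ρ i

  Sat : ∀ {n} → (Fin n → Carrier M) → Formula S n → Set
  Sat ρ (rel r ts) = T (relI M r (evalTs ρ ts))
  Sat ρ (t ≐ u)    = ¬ ¬ (evalT ρ t ≡ evalT ρ u)
  Sat ρ (neg φ)    = ¬ Sat ρ φ
  Sat ρ (φ and ψ)  = Sat ρ φ × Sat ρ ψ
  Sat ρ (all φ)    = (d : Carrier M) → Sat (extend d ρ) φ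

noVars : ∀ {A : Set} → Fin 0 → A
noVars ()

Valid : ∀ {S} → Formula S 0 → Set₁
Valid {S} φ = (M : Structure S) → Sat M noVars φ

_⇒_ : ∀ {S} → Formula S 0 → Formula S 0 → Set₁
A ⇒ B = Valid (A imp B)

-- Σ ∪ Σ' : each symbol tagged with a Bool (true = primed copy).

Two : Vocab → Vocab
Two S = record
  { Fun   = Bool × Fun S
  ; Rel   = Bool × Rel S
  ; funAr = λ p → funAr S (proj₂ p)
  ; relAr = λ p → relAr S (proj₂ p)
  }

module _ {S : Vocab} (b : Bool) where
  mutual
    tagT : ∀ {n} → Term S n → Term (Two S) n
    tagT (var i)    = var i
    tagT (app f ts) = app (b , f) (tagTs ts)

    tagTs : ∀ {n k} → Vec (Term S n) k → Vec (Term (Two S) n) k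
    tagTs []       = []
    tagTs (t ∷ ts) = tagT t ∷ tagTs ts

  tag : ∀ {n} → Formula S n → Formula (Two S) n
  tag (rel r ts) = rel (b , r) (tagTs ts)
  tag (t ≐ u)    = tagT t ≐ tagT u
  tag (neg φ)    = neg (tag φ)
  tag (φ and ψ)  = tag φ and tag ψ
  tag (all φ)    = all (tag φ)

⌜_⌝ : ∀ {S n} → Formula S n → Formula (Two S) n
⌜ φ ⌝ = tag false φ

_′ : ∀ {S n} → Formula S n → Formula (Two S) n
φ ′ = tag true φ

record SafetyProblem (S : Vocab) : Set where
  constructor ⟨_,_,_⟩
  field
    ι : Formula S 0
    τ : Formula (Two S) 0
    β : Formula S 0

PredClass : Vocab → Set₁
PredClass S = Formula S 0 → Set

ClosedUnderConj : ∀ {S} → PredClass S → Set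
ClosedUnderConj P = ∀ φ ψ → P φ → P ψ → P (φ and ψ)

data F-Provable {S : Vocab} (P : PredClass S) : SafetyProblem S → Set₁ where
  Ind  : ∀ ι τ φ → P φ → ι ⇒ φ → (⌜ φ ⌝ and τ) ⇒ (φ ′) →
         F-Provable P ⟨ ι , τ , neg φ ⟩
  Cons : ∀ ι τ φ β → F-Provable P ⟨ ι , τ , neg φ ⟩ → φ ⇒ neg β →
         F-Provable P ⟨ ι , τ , β ⟩

data FI-Provable {S : Vocab} (P : PredClass S) : SafetyProblem S → Set₁ where
  Ind  : ∀ ι τ φ → P φ → ι ⇒ φ → (⌜ φ ⌝ and τ) ⇒ (φ ′) →
         FI-Provable P ⟨ ι , τ , neg φ ⟩
  Cons : ∀ ι τ φ β → FI-Provable P ⟨ ι , τ , neg φ ⟩ → φ ⇒ neg β →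
         FI-Provable P ⟨ ι , τ , β ⟩
  Inc  : ∀ ι τ φ β → FI-Provable P ⟨ ι , τ , neg φ ⟩ →
         FI-Provable P ⟨ ι and φ , (τ and ⌜ φ ⌝) and (φ ′) , β and φ ⟩ →
         FI-Provable P ⟨ ι , τ , β ⟩

{-# OPTIONS --safe #-}
-- An F^P proof amounts to a single inductive invariant ψ ∈ P with ψ ⇒ ¬β:
-- chains of (Cons) collapse because ⇒ is transitive.  Every rule of FI^P
-- preserves the existence of such an invariant.  For (Inc), let ψ₁ be an
-- invariant implying φ and ψ₂ one for the problem strengthened by φ.  Since
-- ψ₁ forces φ before and after every τ-step from ψ₁-states, the strengthened
-- transition relation applies there, so ψ₁ ∧ ψ₂ is an invariant for the
-- original problem; it lies in P by closure under conjunction.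
module Submission where

open import Defs
open import Data.Bool using (Bool; true; false)
open import Data.Fin using (Fin; zero; suc)
open import Data.Product using (_,_)
open import Data.Unit using (tt)
open import Data.Vec using (Vec; []; _∷_)
open import Data.Product.Function.NonDependent.Propositional using (_×-⇔_)
open import Function.Bundles using (_⇔_; mk⇔; Equivalence)
open import Function.Related.TypeIsomorphisms using (¬-cong-⇔)
open import Relation.Nullary using (¬_)
open import Relation.Binary.PropositionalEquality using (_≡_; refl; cong; cong₂; _≗_)
import Function.Properties.Equivalence as ⇔

open Equivalence using (to; from)

Sat-stable : ∀ {S n} (M : Structure S) (ρ : Fin n → Carrier M) (φ : Formula S n) →
             ¬ ¬ Sat M ρ φ → Sat M ρ φ
Sat-stable M ρ (rel r ts) ¬¬s with relI M r (evalTs M ρ ts)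
... | true  = tt
... | false = ¬¬s (λ ())
Sat-stable M ρ (t ≐ u)    ¬¬s = λ ¬e → ¬¬s (λ ¬¬e → ¬¬e ¬e)
Sat-stable M ρ (neg φ)    ¬¬s = λ s → ¬¬s (λ ¬s → ¬s s)
Sat-stable M ρ (φ and ψ)  ¬¬s =
  Sat-stable M ρ φ (λ ¬s → ¬¬s (λ (s , _) → ¬s s)) ,
  Sat-stable M ρ ψ (λ ¬s → ¬¬s (λ (_ , s) → ¬s s))
Sat-stable M ρ (all φ)    ¬¬s = λ d → Sat-stable M (extend M d ρ) φ (λ ¬s → ¬¬s (λ s → ¬s (s d)))

infix 4 _⊨_

_⊨_ : ∀ {S} → Structure S → Formula S 0 → Set
M ⊨ φ = Sat M noVars φ

module _ {S : Vocab} where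

  ⇒-intro : ∀ (A B : Formula S 0) → (∀ M → M ⊨ A → M ⊨ B) → A ⇒ B
  ⇒-intro A B A→B M (a , ¬b) = ¬b (A→B M a)

  ⇒-elim : ∀ (A B : Formula S 0) → A ⇒ B → ∀ M → M ⊨ A → M ⊨ B
  ⇒-elim A B A⇒B M a = Sat-stable M noVars B (λ ¬b → A⇒B M (a , ¬b))

module _ {S : Vocab} (b : Bool) (M : Structure (Two S)) where

  reduct : Structure S
  reduct = record
    { Carrier = Carrier M
    ; point   = point M
    ; funI    = λ f → funI M (b , f)
    ; relI    = λ r → relI M (b , r)
    }

  mutual
    evalT-tag : ∀ {n} {ρ ρ' : Fin n → Carrier M} → ρ ≗ ρ' → (t : Term S n) →
                evalT M ρ (tagT b t) ≡ evalT reduct ρ' t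
    evalT-tag ρ≗ρ' (var i)    = ρ≗ρ' i
    evalT-tag ρ≗ρ' (app f ts) = cong (funI M (b , f)) (evalTs-tag ρ≗ρ' ts)

    evalTs-tag : ∀ {n k} {ρ ρ' : Fin n → Carrier M} → ρ ≗ ρ' → (ts : Vec (Term S n) k) →
                 evalTs M ρ (tagTs b ts) ≡ evalTs reduct ρ' ts
    evalTs-tag ρ≗ρ' []       = refl
    evalTs-tag ρ≗ρ' (t ∷ ts) = cong₂ _∷_ (evalT-tag ρ≗ρ' t) (evalTs-tag ρ≗ρ' ts)

  extend-cong : ∀ {n} {ρ ρ' : Fin n → Carrier M} (d : Carrier M) → ρ ≗ ρ' →
                extend M d ρ ≗ extend reduct d ρ'
  extend-cong d ρ≗ρ' zero    = refl
  extend-cong d ρ≗ρ' (suc i) = ρ≗ρ' i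

  Sat-tag : ∀ {n} {ρ ρ' : Fin n → Carrier M} → ρ ≗ ρ' → (φ : Formula S n) →
            Sat M ρ (tag b φ) ⇔ Sat reduct ρ' φ
  Sat-tag ρ≗ρ' (rel r ts) rewrite evalTs-tag ρ≗ρ' ts = ⇔.refl
  Sat-tag ρ≗ρ' (t ≐ u) rewrite evalT-tag ρ≗ρ' t | evalT-tag ρ≗ρ' u = ⇔.refl
  Sat-tag ρ≗ρ' (neg φ)   = ¬-cong-⇔ (Sat-tag ρ≗ρ' φ)
  Sat-tag ρ≗ρ' (φ and ψ) = Sat-tag ρ≗ρ' φ ×-⇔ Sat-tag ρ≗ρ' ψ
  Sat-tag ρ≗ρ' (all φ)   = mk⇔ (λ s d → to   (Sat-tag (extend-cong d ρ≗ρ') φ) (s d))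
                                (λ s d → from (Sat-tag (extend-cong d ρ≗ρ') φ) (s d))

tag-map : ∀ {S} (A B : Formula S 0) → (∀ N → N ⊨ A → N ⊨ B) →
          ∀ b (M : Structure (Two S)) → M ⊨ tag b A → M ⊨ tag b B
tag-map A B A→B b M a =
  from (Sat-tag b M (λ ()) B) (A→B (reduct b M) (to (Sat-tag b M (λ ()) A) a))

-- Entailment is stated semantically (equivalent to ⇒ by ¬¬-stability) so that
-- the formulas involved stay inferable: Sat is not injective.
record Invariant {S : Vocab} (P : PredClass S) (π : SafetyProblem S) : Set₁ where
  open SafetyProblem π
  field
    inv         : Formula S 0
    inv∈P       : P inv
    initiation  : ∀ M → M ⊨ ι → M ⊨ inv
    consecution : ∀ M → M ⊨ ⌜ inv ⌝ and τ → M ⊨ inv ′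
    safety      : ∀ M → M ⊨ inv → M ⊨ neg β

module _ {S : Vocab} {P : PredClass S} where

  Invariant⇒F-Provable : ∀ {π} → Invariant P π → F-Provable P π
  Invariant⇒F-Provable {⟨ ι , τ , β ⟩} I =
    Cons ι τ inv β
      (Ind ι τ inv inv∈P (⇒-intro ι inv initiation) (⇒-intro (⌜ inv ⌝ and τ) (inv ′) consecution))
      (⇒-intro inv (neg β) safety)
    where open Invariant I

  Ind-invariant : ∀ {ι τ φ} → P φ → ι ⇒ φ → (⌜ φ ⌝ and τ) ⇒ (φ ′) →
                  Invariant P ⟨ ι , τ , neg φ ⟩
  Ind-invariant {ι} {τ} {φ} φ∈P ι⇒φ step = record
    { inv         = φ
    ; inv∈P       = φ∈P
    ; initiation  = ⇒-elim ι φ ι⇒φ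
    ; consecution = ⇒-elim (⌜ φ ⌝ and τ) (φ ′) step
    ; safety      = λ M φ✓ ¬φ✓ → ¬φ✓ φ✓
    }

  inv-implies : ∀ {ι τ φ} (I : Invariant P ⟨ ι , τ , neg φ ⟩) → ∀ M → M ⊨ Invariant.inv I → M ⊨ φ
  inv-implies {φ = φ} I M inv✓ = Sat-stable M noVars φ (Invariant.safety I M inv✓)

  Cons-invariant : ∀ {ι τ φ β} → Invariant P ⟨ ι , τ , neg φ ⟩ → φ ⇒ neg β →
                   Invariant P ⟨ ι , τ , β ⟩
  Cons-invariant {φ = φ} {β} I φ⇒¬β = record
    { inv = inv ; inv∈P = inv∈P ; initiation = initiation ; consecution = consecution
    ; safety = λ M inv✓ → ⇒-elim φ (neg β) φ⇒¬β M (inv-implies I M inv✓)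
    }
    where open Invariant I

  Inc-invariant : ClosedUnderConj P → ∀ {ι τ φ β} →
                  Invariant P ⟨ ι , τ , neg φ ⟩ →
                  Invariant P ⟨ ι and φ , (τ and ⌜ φ ⌝) and (φ ′) , β and φ ⟩ →
                  Invariant P ⟨ ι , τ , β ⟩
  Inc-invariant closed {ι} {τ} {φ} {β} I₁ I₂ = record
    { inv         = ψ₁ and ψ₂
    ; inv∈P       = closed ψ₁ ψ₂ (inv∈P I₁) (inv∈P I₂)
    ; initiation  = initiation′
    ; consecution = consecution′
    ; safety      = λ M (ψ₁✓ , ψ₂✓) β✓ → safety I₂ M ψ₂✓ (β✓ , inv-implies I₁ M ψ₁✓)
    }
    where
    open Invariant
    ψ₁ ψ₂ : Formula S 0
    ψ₁ = inv I₁
    ψ₂ = inv I₂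

    initiation′ : ∀ M → M ⊨ ι → M ⊨ ψ₁ and ψ₂
    initiation′ M ι✓ = ψ₁✓ , initiation I₂ M (ι✓ , inv-implies I₁ M ψ₁✓)
      where
      ψ₁✓ : M ⊨ ψ₁
      ψ₁✓ = initiation I₁ M ι✓

    consecution′ : ∀ M → M ⊨ ⌜ ψ₁ and ψ₂ ⌝ and τ → M ⊨ (ψ₁ and ψ₂) ′
    consecution′ M ((ψ₁✓ , ψ₂✓) , τ✓) = ψ₁′✓ , consecution I₂ M (ψ₂✓ , strengthened-step)
      where
      ψ₁′✓ : M ⊨ ψ₁ ′
      ψ₁′✓ = consecution I₁ M (ψ₁✓ , τ✓)

      strengthened-step : M ⊨ (τ and ⌜ φ ⌝) and (φ ′)
      strengthened-step = (τ✓ , tag-map ψ₁ φ (inv-implies I₁) false M ψ₁✓)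
                        , tag-map ψ₁ φ (inv-implies I₁) true M ψ₁′✓

  FI-Provable⇒Invariant : ClosedUnderConj P → ∀ {π} → FI-Provable P π → Invariant P π
  FI-Provable⇒Invariant closed (Ind _ _ _ φ∈P ι⇒φ step) = Ind-invariant φ∈P ι⇒φ step
  FI-Provable⇒Invariant closed (Cons _ _ _ _ d φ⇒¬β)    =
    Cons-invariant (FI-Provable⇒Invariant closed d) φ⇒¬β
  FI-Provable⇒Invariant closed (Inc _ _ _ _ d₁ d₂)      =
    Inc-invariant closed (FI-Provable⇒Invariant closed d₁) (FI-Provable⇒Invariant closed d₂)

corollary4p8 : (S : Vocab) (P : PredClass S) → ClosedUnderConj P →
    (π : SafetyProblem S) → FI-Provable P π → F-Provable P π
corollary4p8 S P closed π d = Invariant⇒F-Provable (FI-Provable⇒Invariant closed d)
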